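{- For any reflexive frames $\mathcal{F}$ and $\mathcal{F}'$ and any formula $\phi\in\mathcal{L}(W)$, $\mathcal{F}\vDash\phi$ if and only if $\mathcal{F}'\vDash\phi$.
   Context: Fix a nonempty set $\mathbf{P}$ of propositional variables. The language $\mathcal{L}(W)$ is given by $\phi::=p\mid\neg\phi\mid(\phi\land\phi)\mid W\phi$ with $p\in\mathbf{P}$. A frame is $(S,R)$ with $S\neq\emptyset$, $R\subseteq S\times S$; a model $(S,R,V)$ based on it adds $V:\mathbf{P}\to 2^S$. Truth: Boolean clauses as usual; $\mathcal{M},s\vDash W\phi$ iff $\mathcal{M},s\nvDash\phi$ and $\mathcal{M},t\vDash\phi$ for all $t$ with $sRt$. $\mathcal{F}\vDash\phi$ means $\phi$ is true at every state of every model based on $\mathcal{F}$. -}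

module Defs where

open import Data.Product using (_×_)
open import Relation.Nullary using (¬_)
open import Relation.Binary.Core using (Rel)
open import Relation.Binary.Definitions using (Reflexive)

data Form (P : Set) : Set where
  var  : P → Form P
  ¬'_  : Form P → Form P
  _∧'_ : Form P → Form P → Form P
  W    : Form P → Form P

record Frame : Set₁ where
  field
    S      : Set
    inhab  : S
    R      : Rel S _

Valuation : Set → Frame → Set₁
Valuation P F = P → Frame.S F → Set

_,_,_⊨_ : {P : Set} (F : Frame) → Valuation P F → Frame.S F → Form P → Set
F , V , s ⊨ var p    = V p s
F , V , s ⊨ (¬' φ)   = ¬ (F , V , s ⊨ φ)
F , V , s ⊨ (φ ∧' ψ) = (F , V , s ⊨ φ) × (F , V , s ⊨ ψ)
F , V , s ⊨ W φ      = ¬ (F , V , s ⊨ φ) × (∀ t → Frame.R F s t → F , V , t ⊨ φ)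

_⊨F_ : {P : Set} → Frame → Form P → Set₁
F ⊨F φ = ∀ V s → F , V , s ⊨ φ

ReflexiveFrame : Frame → Set
ReflexiveFrame F = Reflexive (Frame.R F)

-- On a reflexive frame W φ can never hold: s R s forces φ true at s, while W φ
-- demands φ false there. So truth of φ at s is decided by the variables true at s
-- alone, with W read as falsum, and validity on any reflexive frame coincides with
-- φ being a tautology under that reading.
module Submission where

open import Defs
open import Data.Empty using (⊥; ⊥-elim)
open import Data.Product using (_×_; _,_)
open import Data.Product.Function.NonDependent.Propositional using (_×-⇔_)
open import Function.Bundles using (_⇔_; mk⇔; Equivalence)
open import Function.Properties.Equivalence using () renaming (sym to ⇔-sym; trans to ⇔-trans)
open import Function.Related.TypeIsomorphisms using (¬-cong-⇔)
open import Relation.Nullary using (¬_)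

_⊨ᵖ_ : {P : Set} → (P → Set) → Form P → Set
ρ ⊨ᵖ var p    = ρ p
ρ ⊨ᵖ (¬' φ)   = ¬ (ρ ⊨ᵖ φ)
ρ ⊨ᵖ (φ ∧' ψ) = (ρ ⊨ᵖ φ) × (ρ ⊨ᵖ ψ)
ρ ⊨ᵖ W φ      = ⊥

Tautology : {P : Set} → Form P → Set₁
Tautology {P} φ = (ρ : P → Set) → ρ ⊨ᵖ φ

localValuation : {P : Set} (F : Frame) → Valuation P F → Frame.S F → P → Set
localValuation F V s p = V p s

constantValuation : {P : Set} (F : Frame) → (P → Set) → Valuation P F
constantValuation F ρ p _ = ρ p

module _ {P : Set} (F : Frame) (V : Valuation P F) where

  W-false-at-reflexive-state : ∀ {s} → Frame.R F s s → (φ : Form P) → ¬ (F , V , s ⊨ W φ)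
  W-false-at-reflexive-state sRs φ (φ-false , φ-true-at-successors) =
    φ-false (φ-true-at-successors _ sRs)

  ⊨⇔local-⊨ᵖ : ∀ {s} → Frame.R F s s → (φ : Form P) →
               (F , V , s ⊨ φ) ⇔ (localValuation F V s ⊨ᵖ φ)
  ⊨⇔local-⊨ᵖ sRs (var p)  = mk⇔ (λ v → v) (λ v → v)
  ⊨⇔local-⊨ᵖ sRs (¬' φ)   = ¬-cong-⇔ (⊨⇔local-⊨ᵖ sRs φ)
  ⊨⇔local-⊨ᵖ sRs (φ ∧' ψ) = ⊨⇔local-⊨ᵖ sRs φ ×-⇔ ⊨⇔local-⊨ᵖ sRs ψ
  ⊨⇔local-⊨ᵖ sRs (W φ)    = mk⇔ (W-false-at-reflexive-state sRs φ) ⊥-elim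

reflexive-valid⇔tautology : {P : Set} (F : Frame) → ReflexiveFrame F →
                            (φ : Form P) → (F ⊨F φ) ⇔ Tautology φ
reflexive-valid⇔tautology F R-refl φ = mk⇔ valid⇒tautology tautology⇒valid
  where
  open Equivalence

  valid⇒tautology : F ⊨F φ → Tautology φ
  valid⇒tautology valid ρ =
    to (⊨⇔local-⊨ᵖ F (constantValuation F ρ) R-refl φ) (valid _ (Frame.inhab F))

  tautology⇒valid : Tautology φ → F ⊨F φ
  tautology⇒valid tautology V s =
    from (⊨⇔local-⊨ᵖ F V R-refl φ) (tautology (localValuation F V s))

mainTheorem13 : (P : Set) → P → (F F′ : Frame) → ReflexiveFrame F → ReflexiveFrame F′
                → (φ : Form P) → (F ⊨F φ) ⇔ (F′ ⊨F φ)
mainTheorem13 P _ F F′ R-refl R′-refl φ =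
  ⇔-trans (reflexive-valid⇔tautology F R-refl φ) (⇔-sym (reflexive-valid⇔tautology F′ R′-refl φ))
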